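{- Let $\mathcal S\subseteq\mathcal K_r$ and let $\Pi^{\mathcal S}$ be the set of all partitions of $V(\mathcal S)\cup R$. Let $T$ be an $r$-restricted Steiner tree all of whose full components belong to $\mathcal K_r$, and let $x\in\{0,1\}^{E(\mathcal S)}\times\{0,1\}^{\mathcal K_r\setminus\mathcal S}$ be the incidence vector of its $\mathcal S$-decomposition, i.e. $x_e=1$ iff $e\in E(T)\cap E(\mathcal S)$ and $x_K=1$ iff $K\in\mathcal K_r(T)\setminus\mathcal S$. Then for every $\pi\in\Pi^{\mathcal S}$, $$\sum_{e\in E_\pi(\mathcal S)}x_e+\sum_{K\in\mathcal K_r\setminus\mathcal S}\mathrm{rc}^\pi_Kx_K\ \ge\ \bar r(\pi)-1 .$$ Consequently this inequality holds for every point of the convex hull of all such incidence vectors.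
   Context: An instance of the Steiner tree problem consists of an undirected graph $G=(V,E)$, terminals $R\subseteq V$ and nonnegative edge costs; vertices outside $R$ are Steiner vertices, and a Steiner tree is a tree containing all terminals. A full component is a tree whose internal vertices are Steiner vertices and whose leaves are terminals; splitting a Steiner tree $T$ at its terminals partitions its edges into full components, whose family is denoted $\mathcal K_r(T)$. For fixed $r\ge2$, an $r$-restricted Steiner tree is one whose full components each have at most $r$ terminals. $\mathcal K_r$ is the family of terminal sets $K$ with $2\le|K|\le r$ that are the terminal set of some full component, each identified with a fixed minimum-cost full component with that terminal set (vertex set $V(K)$, edge set $E(K)$); distinct members of $\mathcal K_r$ are edge-disjoint and share only terminals (Steiner vertices having been cloned), and $G$ is the union of the members of $\mathcal K_r$. For $\mathcal S\subseteq\mathcal K_r$, $V(\mathcal S)$ and $E(\mathcal S)$ are the unions of vertex and edge sets of its members. For a partition $\pi$ of $V(\mathcal S)\cup R$: $E_\pi(\mathcal S)$ is the set of edges of $E(\mathcal S)$ whose endpoints lie in different parts; $\bar r(\pi)$ is the number of parts containing a terminal; for a full component $K$, $\mathrm{rc}^\pi_K$ is the number of parts containing a terminal of $K$, minus $1$.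
   Formalization: The convex hull in the final claim is formed with rational coefficients, so its points have rational coordinates. -}

module Defs where

open import Data.Bool using (Bool; true; false; if_then_else_; not; _∧_; _∨_)
open import Data.Nat as ℕ using (ℕ; zero; suc; _∸_)
open import Data.Fin using (Fin; _≟_)
open import Data.List using (List; []; _∷_; length; filter; map; concatMap; deduplicate; lookup; foldr; allFin)
open import Data.Bool.ListAction using (any)
open import Data.List.Relation.Unary.Unique.Propositional using (Unique)
open import Data.List.Relation.Unary.All using (All)
open import Data.Product using (Σ; _×_; _,_; proj₁; proj₂)
open import Data.Sum using (_⊎_)
open import Data.Integer using (+_)
open import Data.Rational using (ℚ; 0ℚ; 1ℚ; _/_; _+_; _*_; _-_; _≤_)
open import Relation.Binary.PropositionalEquality using (_≡_; _≢_)
open import Relation.Nullary using (¬_)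
open import Relation.Nullary.Decidable using (⌊_⌋)
import Data.Nat as N

-- Multigraphs given by edge lists.  An edge is identified by its
-- position in the list (parallel edges are distinct edges).

module _ {V : Set} where

  Joins : (es : List (V × V)) → Fin (length es) → V → V → Set
  Joins es i u w = (lookup es i ≡ (u , w)) ⊎ (lookup es i ≡ (w , u))

  data Walk (es : List (V × V)) : V → V → Set where
    nil  : ∀ {u} → Walk es u u
    cons : ∀ {u w v} (i : Fin (length es)) → Joins es i u w →
           Walk es w v → Walk es u v

  edgeIdx : ∀ {es u v} → Walk es u v → List (Fin (length es))
  edgeIdx nil = []
  edgeIdx (cons i _ w) = i ∷ edgeIdx w

  -- A closed trail: a closed walk of positive length with pairwise
  -- distinct edges.  A multigraph contains a cycle iff it has one.
  record ClosedTrail (es : List (V × V)) : Set where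
    field
      base     : V
      walk     : Walk es base base
      nonEmpty : edgeIdx walk ≢ []
      distinct : Unique (edgeIdx walk)

  Acyclic : List (V × V) → Set
  Acyclic es = ¬ ClosedTrail es

module _ {n : ℕ} where

  incident : List (Fin n × Fin n) → Fin n → Bool
  incident es v = any (λ e → ⌊ proj₁ e ≟ v ⌋ ∨ ⌊ proj₂ e ≟ v ⌋) es

  -- degree (a loop counts twice)
  degree : List (Fin n × Fin n) → Fin n → ℕ
  degree es v = length (filter (λ e → proj₁ e ≟ v) es)
          ℕ.+ length (filter (λ e → proj₂ e ≟ v) es)

  nLabels : (Fin n → ℕ) → List (Fin n) → ℕ
  nLabels p vs = length (deduplicate N._≟_ (map p vs))

Σℚ : ∀ {k} → (Fin k → ℚ) → ℚ
Σℚ {k} f = foldr (λ i acc → f i + acc) 0ℚ (allFin k)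

ℕ→ℚ : ℕ → ℚ
ℕ→ℚ k = + k / 1

-- The family 𝒦_r is given as m full components indexed by
-- Fin m, each by its edge list comp k; V(K) is the set of vertices
-- incident to its edges.  (Edge costs play no role in the statement.)

record Instance : Set where
  field
    n      : ℕ
    r      : ℕ
    isTerm : Fin n → Bool
    m      : ℕ
    comp   : Fin m → List (Fin n × Fin n)

module _ (I : Instance) where
  open Instance I

  inV : Fin m → Fin n → Bool
  inV k v = incident (comp k) v

  terminals : List (Fin n)
  terminals = filter (λ v → isTerm v Data.Bool.≟ true) (allFin n)

  termsOf : Fin m → List (Fin n)
  termsOf k = filter (λ v → inV k v Data.Bool.≟ true) terminals

  record WellFormed : Set where
    field
      r≥2        : 2 N.≤ r
      compNonEmpty : ∀ k → comp k ≢ []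
      compConn   : ∀ k u v → inV k u ≡ true → inV k v ≡ true → Walk (comp k) u v
      compAcyc   : ∀ k → Acyclic (comp k)
      leafTerm   : ∀ k v → inV k v ≡ true → degree (comp k) v ≡ 1 → isTerm v ≡ true
      innerStein : ∀ k v → inV k v ≡ true → 2 N.≤ degree (comp k) v → isTerm v ≡ false
      sizeLo     : ∀ k → 2 N.≤ length (termsOf k)
      sizeHi     : ∀ k → length (termsOf k) N.≤ r
      -- distinct members have distinct terminal sets and share only
      -- terminals (edge-disjointness is built in: edges are distinct
      -- list entries of distinct components)
      distinctK  : ∀ k l → k ≢ l → termsOf k ≢ termsOf l
      shareTerms : ∀ k l → k ≢ l → ∀ v → inV k v ≡ true → inV l v ≡ true → isTerm v ≡ true

  -- A Steiner tree all of whose full components belong to 𝒦_r is the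
  -- union of a subfamily 𝒯 ⊆ 𝒦_r (given by its indicator), and then
  -- 𝒦_r(T) = 𝒯.  Its edge list:
  edgesOf : (Fin m → Bool) → List (Fin n × Fin n)
  edgesOf 𝒯 = concatMap comp (filter (λ k → 𝒯 k Data.Bool.≟ true) (allFin m))

  inT : (Fin m → Bool) → Fin n → Bool
  inT 𝒯 v = isTerm v ∨ incident (edgesOf 𝒯) v

  -- T is a Steiner tree: a tree (connected, acyclic) containing R.
  -- (It is r-restricted automatically, each member having ≤ r terminals.)
  IsSteinerTree : (Fin m → Bool) → Set
  IsSteinerTree 𝒯 = (∀ u v → inT 𝒯 u ≡ true → inT 𝒯 v ≡ true → Walk (edgesOf 𝒯) u v)
                  × Acyclic (edgesOf 𝒯)

  -- Points of ℝ^{E(𝒮)} × ℝ^{𝒦_r ∖ 𝒮} (rational coordinates): an edge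
  -- coordinate for each edge j of each member k (only k ∈ 𝒮 are used)
  -- and a component coordinate for each k (only k ∉ 𝒮 are used).
  record Point : Set where
    field
      xe : (k : Fin m) → Fin (length (comp k)) → ℚ
      xK : Fin m → ℚ

  incVec : (𝒮 𝒯 : Fin m → Bool) → Point
  incVec 𝒮 𝒯 = record
    { xe = λ k j → if 𝒮 k ∧ 𝒯 k then 1ℚ else 0ℚ
    ; xK = λ k → if not (𝒮 k) ∧ 𝒯 k then 1ℚ else 0ℚ }

  combo : List (ℚ × Point) → Point
  combo cs = record
    { xe = λ k j → foldr (λ c acc → proj₁ c * Point.xe (proj₂ c) k j + acc) 0ℚ cs
    ; xK = λ k → foldr (λ c acc → proj₁ c * Point.xK (proj₂ c) k + acc) 0ℚ cs }

  -- A partition π of V(𝒮) ∪ R is represented by a labelling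
  -- p : Fin n → ℕ (parts = nonempty fibres restricted to V(𝒮) ∪ R;
  -- labels of other vertices are irrelevant).

  rbar : (Fin n → ℕ) → ℕ
  rbar p = nLabels p terminals

  rc : (Fin n → ℕ) → Fin m → ℕ
  rc p k = nLabels p (termsOf k) ∸ 1

  crosses : (Fin n → ℕ) → (k : Fin m) → Fin (length (comp k)) → ℚ
  crosses p k j = if ⌊ p (proj₁ (lookup (comp k) j)) N.≟ p (proj₂ (lookup (comp k) j)) ⌋
                  then 0ℚ else 1ℚ

  lhs : (𝒮 : Fin m → Bool) → (Fin n → ℕ) → Point → ℚ
  lhs 𝒮 p x =
      Σℚ (λ k → if 𝒮 k then Σℚ (λ j → crosses p k j * Point.xe x k j) else 0ℚ)
    + Σℚ (λ k → if 𝒮 k then 0ℚ else ℕ→ℚ (rc p k) * Point.xK x k)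

{-# OPTIONS --safe #-}
module Submission where

-- Fix π, given by the labelling p, and contract T along π to a multigraph on
-- labels: a member K of T in 𝒮 contributes the images of its edges crossing π,
-- a member K ∉ 𝒮 contributes a star on the rc^π_K + 1 labels of the parts
-- meeting its terminals.  At the incidence vector of T the left-hand side is
-- exactly the number of edges of this multigraph.  As T is connected, all
-- labels of terminals lie in one component of it, and a connected multigraph
-- with k edges has at most k + 1 vertices; hence r̄(π) ≤ lhs + 1.  The
-- left-hand side is linear in x, so the bound passes to convex combinations.

open import Defs
open import Algebra.Bundles using (CommutativeRing)
open import Data.Bool as Bool using (Bool; true; false; if_then_else_; not; _∧_; T)
open import Data.Bool.Properties using (T-≡; T-∨; not-¬)
open import Data.Empty using (⊥-elim)
open import Data.Fin as Fin using (Fin; zero; suc)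
import Data.Integer as ℤ
import Data.Integer.Properties as ℤ
open import Data.List
  using (List; []; _∷_; _++_; length; filter; map; foldr; lookup; concatMap; tabulate; allFin; deduplicate)
open import Data.List.Membership.Propositional using (_∈_; find; lose)
open import Data.List.Membership.Propositional.Properties
  using (∈-filter⁺; ∈-filter⁻; ∈-allFin; ∈-map⁺; ∈-map⁻; ∈-deduplicate⁺; ∈-deduplicate⁻;
         ∈-concatMap⁺; ∈-concatMap⁻; ∈-lookup)
open import Data.List.Properties using (length-map; length-++; filter-notAll)
open import Data.List.Relation.Binary.Subset.Propositional using (_⊆_)
open import Data.List.Relation.Unary.All as All using (All; []; _∷_)
import Data.List.Relation.Unary.All.Properties as All
open import Data.List.Relation.Unary.AllPairs using (_∷_)
open import Data.List.Relation.Unary.Any as Any using (Any; here; there)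
open import Data.List.Relation.Unary.Any.Properties using (any⁺)
open import Data.List.Relation.Unary.Unique.Propositional using (Unique)
open import Data.Nat as ℕ using (ℕ; zero; suc)
import Data.Nat.Properties as ℕ
open import Data.List.Relation.Unary.Unique.DecPropositional.Properties ℕ._≟_ using (deduplicate-!)
import Data.Product as Prod
open import Data.Product using (∃-syntax; _×_; _,_; proj₁; proj₂)
open import Data.Rational using (ℚ; 0ℚ; 1ℚ; _+_; _*_; _-_; -_; _≤_; toℚᵘ; nonNegative)
import Data.Rational.Properties as ℚ
open import Data.Rational.Properties
  using (+-identityˡ; +-identityʳ; *-identityʳ; *-zeroʳ; +-monoˡ-≤; +-monoʳ-≤; nonNegative⁻¹;
         normalize-nonNeg; toℚᵘ-injective; toℚᵘ-fromℚᵘ; toℚᵘ-homo-+)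
import Data.Rational.Unnormalised as ℚᵘ
import Data.Rational.Unnormalised.Properties as ℚᵘ
open import Data.Rational.Solver using (module +-*-Solver)
open import Data.Sum using (_⊎_; inj₁; inj₂)
open import Function using (_∘_; Equivalence)
open import Level using (0ℓ)
open import Relation.Binary.Core using (Rel)
open import Relation.Binary.Definitions using (Symmetric; Transitive)
import Relation.Binary.Construct.Closure.Equivalence as EqClosure
open EqClosure using (EqClosure)
open import Relation.Binary.PropositionalEquality
  using (_≡_; _≢_; refl; sym; trans; cong; cong₂; subst; module ≡-Reasoning)
  renaming (isEquivalence to ≡-isEquivalence)
open import Relation.Nullary using (¬_; ¬?; yes; no)
open import Relation.Nullary.Decidable using (⌊_⌋; fromWitness)

open import Algebra.Properties.Semiring.Sum (CommutativeRing.semiring ℚ.+-*-commutativeRing)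
  using (sum; sum-cong-≗; ∑-distrib-+; *-distribˡ-sum; sum-replicate-zero)

-- Multigraphs on ℕ

dedup : List ℕ → List ℕ
dedup = deduplicate ℕ._≟_

Unique-⊆⇒length-≤ : ∀ {U W : List ℕ} → Unique U → U ⊆ W → length U ℕ.≤ length W
Unique-⊆⇒length-≤ {[]} _ _ = ℕ.z≤n
Unique-⊆⇒length-≤ {x ∷ U} {W} (x∉U ∷ uniqU) U⊆W =
  ℕ.≤-trans (ℕ.s≤s (Unique-⊆⇒length-≤ uniqU U⊆W-x)) (filter-notAll (λ y → ¬? (x ℕ.≟ y)) W x∈W)
  where
  U⊆W-x : U ⊆ filter (λ y → ¬? (x ℕ.≟ y)) W
  U⊆W-x y∈U = ∈-filter⁺ (λ y → ¬? (x ℕ.≟ y)) (U⊆W (there y∈U)) (All.lookup x∉U y∈U)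
  x∈W : Any (λ y → ¬ ¬ x ≡ y) W
  x∈W = Any.map (λ { refl x≢x → x≢x refl }) (U⊆W (here refl))

Edge : List (ℕ × ℕ) → Rel ℕ 0ℓ
Edge E a b = (a , b) ∈ E

Connected : List (ℕ × ℕ) → Rel ℕ 0ℓ
Connected E = EqClosure (Edge E)

Connected-sym : ∀ {E} → Symmetric (Connected E)
Connected-sym = EqClosure.symmetric _

Connected-trans : ∀ {E} → Transitive (Connected E)
Connected-trans = EqClosure.transitive _

Connected-mono : ∀ {E F} → E ⊆ F → ∀ {x y} → Connected E x y → Connected F x y
Connected-mono E⊆F = EqClosure.map E⊆F

∈⇒Connected : ∀ {E a b} → (a , b) ∈ E → Connected E a b
∈⇒Connected = EqClosure.return

relabel : (ℕ → ℕ) → List (ℕ × ℕ) → List (ℕ × ℕ)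
relabel f = map (Prod.map f f)

≡⇒Connected : ∀ {E x y} → x ≡ y → Connected E x y
≡⇒Connected refl = EqClosure.reflexive _

Connected-[] : ∀ {x y} → Connected [] x y → x ≡ y
Connected-[] = EqClosure.fold ≡-isEquivalence (λ ())

Connected-dropLoop : ∀ {a E x y} → Connected ((a , a) ∷ E) x y → Connected E x y
Connected-dropLoop = EqClosure.fold (EqClosure.isEquivalence _) λ where
  (here refl) → EqClosure.reflexive _
  (there e)   → ∈⇒Connected e

identify : ℕ → ℕ → ℕ → ℕ
identify a b z with z ℕ.≟ b
... | yes _ = a
... | no  _ = z

identify-target : ∀ a b → identify a b b ≡ a
identify-target a b with b ℕ.≟ b
... | yes _ = refl
... | no b≢b = ⊥-elim (b≢b refl)

identify-other : ∀ a b {z} → z ≢ b → identify a b z ≡ z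
identify-other a b {z} z≢b with z ℕ.≟ b
... | yes z≡b = ⊥-elim (z≢b z≡b)
... | no  _ = refl

Connected-contract : ∀ {a b E x y} → a ≢ b → Connected ((a , b) ∷ E) x y →
  Connected (relabel (identify a b) E) (identify a b x) (identify a b y)
Connected-contract {a} {b} a≢b = EqClosure.gfold (EqClosure.isEquivalence _) (identify a b) λ where
  (here refl) → ≡⇒Connected (trans (identify-other a b a≢b) (sym (identify-target a b)))
  (there e)   → ∈⇒Connected (∈-map⁺ (Prod.map (identify a b) (identify a b)) e)

length-dedup-identify : ∀ a b L → length (dedup L) ℕ.≤ suc (length (dedup (map (identify a b) L)))
length-dedup-identify a b L = Unique-⊆⇒length-≤ (deduplicate-! L) dedupL⊆b∷D
  where
  dedupL⊆b∷D : dedup L ⊆ b ∷ dedup (map (identify a b) L)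
  dedupL⊆b∷D {x} x∈ with x ℕ.≟ b
  ... | yes x≡b = here x≡b
  ... | no  x≢b = there (∈-deduplicate⁺ ℕ._≟_
        (subst (_∈ _) (identify-other a b x≢b) (∈-map⁺ (identify a b) (∈-deduplicate⁻ ℕ._≟_ L x∈))))

-- Contracting an edge keeps the length of the edge list but not its
-- structure, so the recursion is on the length n.
length-dedup-Connected : ∀ {E x L} → All (Connected E x) L → length (dedup L) ℕ.≤ suc (length E)
length-dedup-Connected {E} {x} {L} = go _ E refl x L
  where
  go : ∀ n E → length E ≡ n → ∀ x L → All (Connected E x) L → length (dedup L) ℕ.≤ suc (length E)
  go _ [] _ x L conn =
    Unique-⊆⇒length-≤ {W = x ∷ []} (deduplicate-! L) λ y∈ →
      here (sym (Connected-[] (All.lookup conn (∈-deduplicate⁻ ℕ._≟_ L y∈))))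
  go (suc n) ((a , b) ∷ E) |E|≡1+n x L conn with a ℕ.≟ b
  ... | yes refl = ℕ.m≤n⇒m≤1+n
        (go n E (ℕ.suc-injective |E|≡1+n) x L (All.map Connected-dropLoop conn))
  ... | no  a≢b =
    ℕ.≤-trans (length-dedup-identify a b L) (ℕ.s≤s (subst (λ k → _ ℕ.≤ suc k) (length-map _ E) ih))
    where
    f : ℕ → ℕ
    f = identify a b
    conn′ : All (Connected (relabel f E) (f x)) (map f L)
    conn′ = All.tabulate λ y∈ → let z , z∈ , y≡fz = ∈-map⁻ f y∈ in
      subst (Connected _ (f x)) (sym y≡fz) (Connected-contract a≢b (All.lookup conn z∈))
    ih : length (dedup (map f L)) ℕ.≤ suc (length (relabel f E))
    ih = go n (relabel f E)
           (trans (length-map _ E) (ℕ.suc-injective |E|≡1+n)) (f x) (map f L) conn′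

length-dedup-map-Connected : ∀ {A : Set} (f : A → ℕ) {E} xs →
  (∀ {a b} → a ∈ xs → b ∈ xs → Connected E (f a) (f b)) →
  length (dedup (map f xs)) ℕ.≤ suc (length E)
length-dedup-map-Connected f []       _    = ℕ.z≤n
length-dedup-map-Connected f (x ∷ xs) conn =
  length-dedup-Connected (All.map⁺ (All.tabulate (conn (here refl))))

star : List ℕ → List (ℕ × ℕ)
star []      = []
star (h ∷ t) = map (h ,_) t

length-star : ∀ ds → length (star ds) ≡ length ds ℕ.∸ 1
length-star []      = refl
length-star (h ∷ t) = length-map (h ,_) t

star-Connected : ∀ {ds x y} → x ∈ ds → y ∈ ds → Connected (star ds) x y
star-Connected {h ∷ t} x∈ y∈ = Connected-trans (toHub x∈) (Connected-sym (toHub y∈))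
  where
  toHub : ∀ {z} → z ∈ h ∷ t → Connected (star (h ∷ t)) z h
  toHub (here refl) = EqClosure.reflexive _
  toHub (there z∈t) = Connected-sym (∈⇒Connected (∈-map⁺ (h ,_) z∈t))

foldr-tabulate≡sum : ∀ {n k} (f : Fin k → ℚ) (h : Fin n → Fin k) →
  foldr (λ i acc → f i + acc) 0ℚ (tabulate h) ≡ sum (f ∘ h)
foldr-tabulate≡sum {zero}  f h = refl
foldr-tabulate≡sum {suc n} f h = cong (f (h zero) +_) (foldr-tabulate≡sum f (h ∘ suc))

Σℚ≡sum : ∀ {k} (f : Fin k → ℚ) → Σℚ f ≡ sum f
Σℚ≡sum f = foldr-tabulate≡sum f (λ i → i)

Σℚ-suc : ∀ {k} (f : Fin (suc k) → ℚ) → Σℚ f ≡ f zero + Σℚ (f ∘ suc)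
Σℚ-suc f = trans (Σℚ≡sum f) (cong (f zero +_) (sym (Σℚ≡sum (f ∘ suc))))

Σℚ-cong : ∀ {k} {f g : Fin k → ℚ} → (∀ i → f i ≡ g i) → Σℚ f ≡ Σℚ g
Σℚ-cong {f = f} {g} f≗g = begin
  Σℚ f ≡⟨ Σℚ≡sum f ⟩
  sum f ≡⟨ sum-cong-≗ f≗g ⟩
  sum g ≡⟨ Σℚ≡sum g ⟨
  Σℚ g ∎
  where open ≡-Reasoning

Σℚ-zero : ∀ {k} {f : Fin k → ℚ} → (∀ i → f i ≡ 0ℚ) → Σℚ f ≡ 0ℚ
Σℚ-zero {k} f≗0 = trans (Σℚ-cong f≗0) (trans (Σℚ≡sum {k} (λ _ → 0ℚ)) (sum-replicate-zero k))

Σℚ-+ : ∀ {k} (f g : Fin k → ℚ) → Σℚ f + Σℚ g ≡ Σℚ (λ i → f i + g i)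
Σℚ-+ f g = begin
  Σℚ f + Σℚ g             ≡⟨ cong₂ _+_ (Σℚ≡sum f) (Σℚ≡sum g) ⟩
  sum f + sum g           ≡⟨ ∑-distrib-+ f g ⟨
  sum (λ i → f i + g i)   ≡⟨ Σℚ≡sum (λ i → f i + g i) ⟨
  Σℚ (λ i → f i + g i)    ∎
  where open ≡-Reasoning

Σℚ-linear : ∀ {k} (l : ℚ) {f g h : Fin k → ℚ} → (∀ i → f i ≡ l * g i + h i) →
  Σℚ f ≡ l * Σℚ g + Σℚ h
Σℚ-linear l {f} {g} {h} f≗lg+h = begin
  Σℚ f                         ≡⟨ Σℚ-cong f≗lg+h ⟩
  Σℚ (λ i → l * g i + h i)     ≡⟨ Σℚ-+ (λ i → l * g i) h ⟨
  Σℚ (λ i → l * g i) + Σℚ h    ≡⟨ cong (_+ Σℚ h) (trans (Σℚ≡sum (λ i → l * g i)) (sym (*-distribˡ-sum l g))) ⟩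
  l * sum g + Σℚ h             ≡⟨ cong (λ s → l * s + Σℚ h) (Σℚ≡sum g) ⟨
  l * Σℚ g + Σℚ h              ∎
  where open ≡-Reasoning

ℕ→ℚ-+ : ∀ a b → ℕ→ℚ (a ℕ.+ b) ≡ ℕ→ℚ a + ℕ→ℚ b
ℕ→ℚ-+ a b = toℚᵘ-injective (begin
  toℚᵘ (ℕ→ℚ (a ℕ.+ b))            ≈⟨ toℚᵘ-fromℚᵘ (ℕᵘ (a ℕ.+ b)) ⟩
  ℕᵘ (a ℕ.+ b)                    ≈⟨ ℚᵘ.*≡* ↥a+b≡↥a+↥b ⟩
  ℕᵘ a ℚᵘ.+ ℕᵘ b                  ≈⟨ ℚᵘ.+-cong (toℚᵘ-fromℚᵘ (ℕᵘ a)) (toℚᵘ-fromℚᵘ (ℕᵘ b)) ⟨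
  toℚᵘ (ℕ→ℚ a) ℚᵘ.+ toℚᵘ (ℕ→ℚ b)  ≈⟨ toℚᵘ-homo-+ (ℕ→ℚ a) (ℕ→ℚ b) ⟨
  toℚᵘ (ℕ→ℚ a + ℕ→ℚ b)            ∎)
  where
  open ℚᵘ.≃-Reasoning
  ℕᵘ : ℕ → ℚᵘ.ℚᵘ
  ℕᵘ k = ℚᵘ.mkℚᵘ (ℤ.+ k) 0
  ↥a+b≡↥a+↥b : ℤ.+ (a ℕ.+ b) ℤ.* ℤ.+ 1 ≡ (ℤ.+ a ℤ.* ℤ.+ 1 ℤ.+ ℤ.+ b ℤ.* ℤ.+ 1) ℤ.* ℤ.+ 1
  ↥a+b≡↥a+↥b = trans (ℤ.*-identityʳ _) (trans (ℤ.pos-+ a b) (sym (trans (ℤ.*-identityʳ _)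
    (cong₂ ℤ._+_ (ℤ.*-identityʳ (ℤ.+ a)) (ℤ.*-identityʳ (ℤ.+ b))))))

ℕ→ℚ-nonNeg : ∀ k → 0ℚ ≤ ℕ→ℚ k
ℕ→ℚ-nonNeg k = nonNegative⁻¹ (ℕ→ℚ k) {{normalize-nonNeg k 1}}

ℕ→ℚ-mono-≤ : ∀ {a b} → a ℕ.≤ b → ℕ→ℚ a ≤ ℕ→ℚ b
ℕ→ℚ-mono-≤ {a} {b} a≤b = subst (ℕ→ℚ a ≤_) b≡a+d
  (subst (_≤ ℕ→ℚ a + ℕ→ℚ d) (+-identityʳ (ℕ→ℚ a)) (+-monoʳ-≤ (ℕ→ℚ a) (ℕ→ℚ-nonNeg d)))
  where
  d = b ℕ.∸ a
  b≡a+d : ℕ→ℚ a + ℕ→ℚ d ≡ ℕ→ℚ b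
  b≡a+d = trans (sym (ℕ→ℚ-+ a d)) (cong ℕ→ℚ (ℕ.m+[n∸m]≡n a≤b))

ℕ→ℚ-∸1-≤ : ∀ {a b} → a ℕ.≤ suc b → ℕ→ℚ a - 1ℚ ≤ ℕ→ℚ b
ℕ→ℚ-∸1-≤ {a} {b} a≤1+b = subst (ℕ→ℚ a - 1ℚ ≤_) 1+b-1≡b (+-monoˡ-≤ (- 1ℚ) (ℕ→ℚ-mono-≤ a≤1+b))
  where
  open +-*-Solver
  1+b-1≡b : ℕ→ℚ (suc b) - 1ℚ ≡ ℕ→ℚ b
  1+b-1≡b = trans (cong (_- 1ℚ) (ℕ→ℚ-+ 1 b))
    (solve 1 (λ x → (con 1ℚ :+ x) :- con 1ℚ := x) refl (ℕ→ℚ b))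

ℕ→ℚ-length-concatMap : ∀ {A B : Set} (g : A → List B) xs →
  ℕ→ℚ (length (concatMap g xs)) ≡ foldr (λ x acc → ℕ→ℚ (length (g x)) + acc) 0ℚ xs
ℕ→ℚ-length-concatMap g []       = refl
ℕ→ℚ-length-concatMap g (x ∷ xs) = begin
  ℕ→ℚ (length (g x ++ concatMap g xs))            ≡⟨ cong ℕ→ℚ (length-++ (g x)) ⟩
  ℕ→ℚ (length (g x) ℕ.+ length (concatMap g xs))  ≡⟨ ℕ→ℚ-+ (length (g x)) _ ⟩
  ℕ→ℚ (length (g x)) + ℕ→ℚ (length (concatMap g xs))
    ≡⟨ cong (ℕ→ℚ (length (g x)) +_) (ℕ→ℚ-length-concatMap g xs) ⟩
  ℕ→ℚ (length (g x)) + foldr (λ x acc → ℕ→ℚ (length (g x)) + acc) 0ℚ xs ∎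
  where open ≡-Reasoning

Adjacent : ∀ {n} → List (Fin n × Fin n) → Fin n → Fin n → Set
Adjacent es u w = (u , w) ∈ es ⊎ (w , u) ∈ es

module Members (I : Instance) where
  open Instance I

  ∈-terminals : ∀ {v} → isTerm v ≡ true → v ∈ terminals I
  ∈-terminals {v} isTerm-v = ∈-filter⁺ (λ v → isTerm v Bool.≟ true) (∈-allFin v) isTerm-v

  ∈-terminals⁻ : ∀ {v} → v ∈ terminals I → isTerm v ≡ true
  ∈-terminals⁻ v∈ = proj₂ (∈-filter⁻ (λ v → isTerm v Bool.≟ true) {xs = allFin n} v∈)

  ∈-termsOf : ∀ {k v} → isTerm v ≡ true → inV I k v ≡ true → v ∈ termsOf I k
  ∈-termsOf {k} isTerm-v v∈K = ∈-filter⁺ (λ v → inV I k v Bool.≟ true) (∈-terminals isTerm-v) v∈K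

  inV-endpoints : ∀ {k u w} → (u , w) ∈ comp k → inV I k u ≡ true × inV I k w ≡ true
  inV-endpoints {k} {u} {w} uw∈ = incident-by (inj₁ (fromWitness refl)) , incident-by (inj₂ (fromWitness refl))
    where
    incident-by : ∀ {v} → T ⌊ u Fin.≟ v ⌋ ⊎ T ⌊ w Fin.≟ v ⌋ → inV I k v ≡ true
    incident-by hit = Equivalence.to T-≡ (any⁺ _ (lose uw∈ (Equivalence.from T-∨ hit)))

  inV-Adjacent : ∀ {k u w} → Adjacent (comp k) u w → inV I k u ≡ true × inV I k w ≡ true
  inV-Adjacent (inj₁ uw∈) = inV-endpoints uw∈
  inV-Adjacent (inj₂ wu∈) = let w∈K , u∈K = inV-endpoints wu∈ in u∈K , w∈K

  Joins⇒member : ∀ {𝒯 i u w} → Joins (edgesOf I 𝒯) i u w → ∃[ k ] 𝒯 k ≡ true × Adjacent (comp k) u w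
  Joins⇒member {𝒯} {i} joins
    with k , k∈𝒯 , e∈K ←
           find (∈-concatMap⁻ comp {xs = filter (λ k → 𝒯 k Bool.≟ true) (allFin m)} (∈-lookup i))
    = k , proj₂ (∈-filter⁻ (λ k → 𝒯 k Bool.≟ true) {xs = allFin m} k∈𝒯) , orient joins
    where
    orient : ∀ {u w} → Joins (edgesOf I 𝒯) i u w → Adjacent (comp k) u w
    orient (inj₁ e≡uw) = inj₁ (subst (_∈ comp k) e≡uw e∈K)
    orient (inj₂ e≡wu) = inj₂ (subst (_∈ comp k) e≡wu e∈K)

  ∃-∈-termsOf : WellFormed I → ∀ k → ∃[ t ] t ∈ termsOf I k
  ∃-∈-termsOf wf k with termsOf I k | WellFormed.sizeLo wf k
  ... | []    | ()
  ... | t ∷ _ | _  = t , here refl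

-- Contracting a Steiner tree along a partition

module Contraction (I : Instance) (wf : WellFormed I) (𝒮 𝒯 : Fin (Instance.m I) → Bool)
                   (p : Fin (Instance.n I) → ℕ) where
  open Instance I
  open WellFormed wf
  open Members I

  crossingLabels : List (Fin n × Fin n) → List (ℕ × ℕ)
  crossingLabels []             = []
  crossingLabels ((u , w) ∷ es) with p u ℕ.≟ p w
  ... | yes _ = crossingLabels es
  ... | no  _ = (p u , p w) ∷ crossingLabels es

  ∈-crossingLabels : ∀ {es u w} → (u , w) ∈ es → p u ≡ p w ⊎ (p u , p w) ∈ crossingLabels es
  ∈-crossingLabels {(u , w) ∷ es} (here refl) with p u ℕ.≟ p w
  ... | yes pu≡pw = inj₁ pu≡pw
  ... | no  _     = inj₂ (here refl)
  ∈-crossingLabels {(u′ , w′) ∷ es} (there e∈) with p u′ ℕ.≟ p w′ | ∈-crossingLabels {es} e∈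
  ... | yes _ | r           = r
  ... | no  _ | inj₁ eq     = inj₁ eq
  ... | no  _ | inj₂ e′∈    = inj₂ (there e′∈)

  partLabels : Fin m → List ℕ
  partLabels k = dedup (map p (termsOf I k))

  memberEdges : Fin m → List (ℕ × ℕ)
  memberEdges k = if 𝒯 k then (if 𝒮 k then crossingLabels (comp k) else star (partLabels k)) else []

  contracted : List (ℕ × ℕ)
  contracted = concatMap memberEdges (allFin m)

  -- crosses I p k is crossingIndicator (comp k); the induction below needs arbitrary lists.
  crossingIndicator : (es : List (Fin n × Fin n)) → Fin (length es) → ℚ
  crossingIndicator es j =
    if ⌊ p (proj₁ (lookup es j)) ℕ.≟ p (proj₂ (lookup es j)) ⌋ then 0ℚ else 1ℚ

  Σℚ-crossingIndicator : ∀ es → Σℚ (crossingIndicator es) ≡ ℕ→ℚ (length (crossingLabels es))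
  Σℚ-crossingIndicator []             = refl
  Σℚ-crossingIndicator ((u , w) ∷ es) =
    trans (Σℚ-suc (crossingIndicator ((u , w) ∷ es))) (step (Σℚ-crossingIndicator es))
    where
    step : Σℚ (crossingIndicator es) ≡ ℕ→ℚ (length (crossingLabels es)) →
           crossingIndicator ((u , w) ∷ es) zero + Σℚ (crossingIndicator es)
             ≡ ℕ→ℚ (length (crossingLabels ((u , w) ∷ es)))
    step ih with p u ℕ.≟ p w
    ... | yes _ = trans (+-identityˡ _) ih
    ... | no  _ = trans (cong (1ℚ +_) ih) (sym (ℕ→ℚ-+ 1 (length (crossingLabels es))))

  incVec-summand : ∀ (s t : Bool) {L} (c : Fin L → ℚ) (r : ℕ) (CE SE : List (ℕ × ℕ)) →
    Σℚ c ≡ ℕ→ℚ (length CE) → r ≡ length SE →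
    (if s then Σℚ (λ j → c j * (if s ∧ t then 1ℚ else 0ℚ)) else 0ℚ)
      + (if s then 0ℚ else ℕ→ℚ r * (if not s ∧ t then 1ℚ else 0ℚ))
      ≡ ℕ→ℚ (length (if t then (if s then CE else SE) else []))
  incVec-summand true  true  c _ _ _ Σc≡ _  =
    trans (+-identityʳ (Σℚ (λ j → c j * 1ℚ))) (trans (Σℚ-cong (λ j → *-identityʳ (c j))) Σc≡)
  incVec-summand true  false c _ _ _ _   _  =
    trans (+-identityʳ (Σℚ (λ j → c j * 0ℚ))) (Σℚ-zero (λ j → *-zeroʳ (c j)))
  incVec-summand false true  _ r _ _ _   r≡ =
    trans (+-identityˡ (ℕ→ℚ r * 1ℚ)) (trans (*-identityʳ (ℕ→ℚ r)) (cong ℕ→ℚ r≡))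
  incVec-summand false false _ r _ _ _   _  = trans (+-identityˡ (ℕ→ℚ r * 0ℚ)) (*-zeroʳ (ℕ→ℚ r))

  lhs-incVec : lhs I 𝒮 p (incVec I 𝒮 𝒯) ≡ ℕ→ℚ (length contracted)
  lhs-incVec = begin
    lhs I 𝒮 p (incVec I 𝒮 𝒯)                  ≡⟨ Σℚ-+ edgePart componentPart ⟩
    Σℚ (λ k → edgePart k + componentPart k)   ≡⟨ Σℚ-cong summand ⟩
    Σℚ (λ k → ℕ→ℚ (length (memberEdges k)))   ≡⟨ ℕ→ℚ-length-concatMap memberEdges (allFin m) ⟨
    ℕ→ℚ (length contracted)                   ∎
    where
    open ≡-Reasoning
    x : Point I
    x = incVec I 𝒮 𝒯
    edgePart componentPart : Fin m → ℚ
    edgePart k = if 𝒮 k then Σℚ (λ j → crosses I p k j * Point.xe x k j) else 0ℚ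
    componentPart k = if 𝒮 k then 0ℚ else ℕ→ℚ (rc I p k) * Point.xK x k
    summand : ∀ k → edgePart k + componentPart k ≡ ℕ→ℚ (length (memberEdges k))
    summand k = incVec-summand (𝒮 k) (𝒯 k) (crossingIndicator (comp k)) (rc I p k)
      (crossingLabels (comp k)) (star (partLabels k))
      (Σℚ-crossingIndicator (comp k)) (sym (length-star (partLabels k)))

  R∪V𝒮 : Fin n → Set
  R∪V𝒮 v = isTerm v ≡ true ⊎ ∃[ k ] 𝒮 k ≡ true × inV I k v ≡ true

  TermLabel : Fin m → ℕ → Set
  TermLabel k ℓ = ∃[ t ] t ∈ termsOf I k × ℓ ≡ p t

  -- π only labels R ∪ V(𝒮).  A Steiner vertex outside V(𝒮) lies in a single
  -- member K ∉ 𝒮, and any part meeting the terminals of K can stand for it.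
  Represents : Fin n → ℕ → Set
  Represents v ℓ = (ℓ ≡ p v × R∪V𝒮 v)
                 ⊎ (isTerm v ≡ false × ∃[ k ] 𝒮 k ≡ false × inV I k v ≡ true × TermLabel k ℓ)

  ∈𝒮-∉𝒮-distinct : ∀ {k k′} → 𝒮 k ≡ true → 𝒮 k′ ≡ false → k ≢ k′
  ∈𝒮-∉𝒮-distinct k∈𝒮 k′∉𝒮 refl = not-¬ k∈𝒮 k′∉𝒮

  Represents-∈𝒮 : ∀ {k v ℓ} → 𝒮 k ≡ true → inV I k v ≡ true → Represents v ℓ → ℓ ≡ p v
  Represents-∈𝒮 _ _ (inj₁ (ℓ≡pv , _)) = ℓ≡pv
  Represents-∈𝒮 {k} {v} k∈𝒮 v∈K (inj₂ (steiner , k′ , k′∉𝒮 , v∈K′ , _)) =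
    ⊥-elim (not-¬ (shareTerms k′ k (∈𝒮-∉𝒮-distinct k∈𝒮 k′∉𝒮 ∘ sym) v v∈K′ v∈K) steiner)

  Represents-∉𝒮 : ∀ {k v ℓ} → 𝒮 k ≡ false → inV I k v ≡ true → Represents v ℓ → TermLabel k ℓ
  Represents-∉𝒮 {k} {v} _ v∈K (inj₁ (ℓ≡pv , inj₁ terminal)) = v , ∈-termsOf terminal v∈K , ℓ≡pv
  Represents-∉𝒮 {k} {v} k∉𝒮 v∈K (inj₁ (ℓ≡pv , inj₂ (k′ , k′∈𝒮 , v∈K′))) =
    v , ∈-termsOf (shareTerms k′ k (∈𝒮-∉𝒮-distinct k′∈𝒮 k∉𝒮) v v∈K′ v∈K) v∈K , ℓ≡pv
  Represents-∉𝒮 {k} {v} _ v∈K (inj₂ (steiner , k′ , _ , v∈K′ , label)) with k′ Fin.≟ k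
  ... | yes refl = label
  ... | no  k′≢k = ⊥-elim (not-¬ (shareTerms k′ k k′≢k v v∈K′ v∈K) steiner)

  represented-∉𝒮 : ∀ {k w} → 𝒮 k ≡ false → inV I k w ≡ true → ∃[ ℓ ] Represents w ℓ × TermLabel k ℓ
  represented-∉𝒮 {k} {w} k∉𝒮 w∈K with isTerm w in terminal
  ... | true  = p w , inj₁ (refl , inj₁ refl) , (w , ∈-termsOf terminal w∈K , refl)
  ... | false = let t , t∈ = ∃-∈-termsOf wf k in
                p t , inj₂ (refl , k , k∉𝒮 , w∈K , (t , t∈ , refl)) , (t , t∈ , refl)

  memberEdges⊆contracted : ∀ k → memberEdges k ⊆ contracted
  memberEdges⊆contracted k e∈ = ∈-concatMap⁺ memberEdges (lose (∈-allFin k) e∈)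

  memberEdges-∈𝒮 : ∀ {k} → 𝒮 k ≡ true → 𝒯 k ≡ true → memberEdges k ≡ crossingLabels (comp k)
  memberEdges-∈𝒮 k∈𝒮 k∈𝒯 rewrite k∈𝒮 | k∈𝒯 = refl

  memberEdges-∉𝒮 : ∀ {k} → 𝒮 k ≡ false → 𝒯 k ≡ true → memberEdges k ≡ star (partLabels k)
  memberEdges-∉𝒮 k∉𝒮 k∈𝒯 rewrite k∉𝒮 | k∈𝒯 = refl

  Adjacent-∈𝒮-Connected : ∀ {k u w} → 𝒮 k ≡ true → 𝒯 k ≡ true → Adjacent (comp k) u w →
    Connected contracted (p u) (p w)
  Adjacent-∈𝒮-Connected {k} k∈𝒮 k∈𝒯 (inj₁ uw∈) = edge-Connected uw∈
    where
    crossing⊆contracted : crossingLabels (comp k) ⊆ contracted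
    crossing⊆contracted = subst (_⊆ contracted) (memberEdges-∈𝒮 k∈𝒮 k∈𝒯) (memberEdges⊆contracted k)
    edge-Connected : ∀ {u w} → (u , w) ∈ comp k → Connected contracted (p u) (p w)
    edge-Connected uw∈ with ∈-crossingLabels uw∈
    ... | inj₁ pu≡pw = ≡⇒Connected pu≡pw
    ... | inj₂ e∈    = ∈⇒Connected (crossing⊆contracted e∈)
  Adjacent-∈𝒮-Connected k∈𝒮 k∈𝒯 (inj₂ wu∈) = Connected-sym (Adjacent-∈𝒮-Connected k∈𝒮 k∈𝒯 (inj₁ wu∈))

  TermLabel-∉𝒮-Connected : ∀ {k ℓ ℓ′} → 𝒮 k ≡ false → 𝒯 k ≡ true → TermLabel k ℓ → TermLabel k ℓ′ →
    Connected contracted ℓ ℓ′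
  TermLabel-∉𝒮-Connected {k} k∉𝒮 k∈𝒯 (t , t∈ , refl) (t′ , t′∈ , refl) =
    Connected-mono star⊆contracted (star-Connected (∈-partLabels t∈) (∈-partLabels t′∈))
    where
    star⊆contracted : star (partLabels k) ⊆ contracted
    star⊆contracted = subst (_⊆ contracted) (memberEdges-∉𝒮 k∉𝒮 k∈𝒯) (memberEdges⊆contracted k)
    ∈-partLabels : ∀ {t} → t ∈ termsOf I k → p t ∈ partLabels k
    ∈-partLabels t∈ = ∈-deduplicate⁺ ℕ._≟_ (∈-map⁺ p t∈)

  walk-Connected : ∀ {v t ℓ} → Walk (edgesOf I 𝒯) v t → isTerm t ≡ true → Represents v ℓ →
    Connected contracted ℓ (p t)
  walk-Connected nil _        (inj₁ (ℓ≡pt , _))    = ≡⇒Connected ℓ≡pt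
  walk-Connected nil terminal (inj₂ (steiner , _)) = ⊥-elim (not-¬ terminal steiner)
  walk-Connected (cons i joins rest) terminal rep with Joins⇒member joins
  ... | k , k∈𝒯 , adj with inV-Adjacent adj | 𝒮 k in k∈?𝒮
  ...   | u∈K , w∈K | true  = Connected-trans (≡⇒Connected (Represents-∈𝒮 k∈?𝒮 u∈K rep))
          (Connected-trans (Adjacent-∈𝒮-Connected k∈?𝒮 k∈𝒯 adj)
                           (walk-Connected rest terminal (inj₁ (refl , inj₂ (k , k∈?𝒮 , w∈K)))))
  ...   | u∈K , w∈K | false = let ℓ′ , rep′ , label′ = represented-∉𝒮 k∈?𝒮 w∈K in
          Connected-trans (TermLabel-∉𝒮-Connected k∈?𝒮 k∈𝒯 (Represents-∉𝒮 k∈?𝒮 u∈K rep) label′)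
                          (walk-Connected rest terminal rep′)

  terminals-Connected : IsSteinerTree I 𝒯 → ∀ {s t} → isTerm s ≡ true → isTerm t ≡ true →
    Connected contracted (p s) (p t)
  terminals-Connected (spanning , _) s∈R t∈R =
    walk-Connected (spanning _ _ (inT-terminal s∈R) (inT-terminal t∈R)) t∈R (inj₁ (refl , inj₁ s∈R))
    where
    inT-terminal : ∀ {v} → isTerm v ≡ true → inT I 𝒯 v ≡ true
    inT-terminal v∈R rewrite v∈R = refl

  rbar-≤ : IsSteinerTree I 𝒯 → rbar I p ℕ.≤ suc (length contracted)
  rbar-≤ tree = length-dedup-map-Connected p (terminals I) λ s∈ t∈ →
    terminals-Connected tree (∈-terminals⁻ s∈) (∈-terminals⁻ t∈)

  incVec-inequality : IsSteinerTree I 𝒯 → ℕ→ℚ (rbar I p) - 1ℚ ≤ lhs I 𝒮 p (incVec I 𝒮 𝒯)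
  incVec-inequality tree = subst (ℕ→ℚ (rbar I p) - 1ℚ ≤_) (sym lhs-incVec) (ℕ→ℚ-∸1-≤ (rbar-≤ tree))

-- Linearity of the left-hand side

if-linear : ∀ (s : Bool) {l x x′ y y′ z z′ : ℚ} → x ≡ l * y + z → x′ ≡ l * y′ + z′ →
  (if s then x else x′) ≡ l * (if s then y else y′) + (if s then z else z′)
if-linear true  x≡ _  = x≡
if-linear false _  x′≡ = x′≡

module Linearity (I : Instance) (𝒮 : Fin (Instance.m I) → Bool) (p : Fin (Instance.n I) → ℕ) where
  open Instance I
  open +-*-Solver

  0≡l*0+0 : ∀ l → 0ℚ ≡ l * 0ℚ + 0ℚ
  0≡l*0+0 = solve 1 (λ l → con 0ℚ := l :* con 0ℚ :+ con 0ℚ) refl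

  scale-linear : ∀ c l a b → c * (l * a + b) ≡ l * (c * a) + c * b
  scale-linear = solve 4 (λ c l a b → c :* (l :* a :+ b) := l :* (c :* a) :+ c :* b) refl

  lhs-combo-[] : lhs I 𝒮 p (combo I []) ≡ 0ℚ
  lhs-combo-[] = cong₂ _+_ (Σℚ-zero edgePart≡0) (Σℚ-zero componentPart≡0)
    where
    edgePart≡0 : ∀ k → (if 𝒮 k then Σℚ (λ j → crosses I p k j * 0ℚ) else 0ℚ) ≡ 0ℚ
    edgePart≡0 k with 𝒮 k
    ... | true  = Σℚ-zero (λ j → *-zeroʳ (crosses I p k j))
    ... | false = refl
    componentPart≡0 : ∀ k → (if 𝒮 k then 0ℚ else ℕ→ℚ (rc I p k) * 0ℚ) ≡ 0ℚ
    componentPart≡0 k with 𝒮 k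
    ... | true  = refl
    ... | false = *-zeroʳ (ℕ→ℚ (rc I p k))

  lhs-combo-∷ : ∀ l x rest →
    lhs I 𝒮 p (combo I ((l , x) ∷ rest)) ≡ l * lhs I 𝒮 p x + lhs I 𝒮 p (combo I rest)
  lhs-combo-∷ l x rest = trans
    (cong₂ _+_ (Σℚ-linear l edgePart) (Σℚ-linear l componentPart))
    (solve 5 (λ l a b c d → (l :* a :+ b) :+ (l :* c :+ d) := l :* (a :+ c) :+ (b :+ d)) refl
       l (Σℚ (edgeSum x)) (Σℚ (edgeSum y)) (Σℚ (componentSum x)) (Σℚ (componentSum y)))
    where
    y : Point I
    y = combo I rest
    edgeSum componentSum : Point I → Fin m → ℚ
    edgeSum z k = if 𝒮 k then Σℚ (λ j → crosses I p k j * Point.xe z k j) else 0ℚ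
    componentSum z k = if 𝒮 k then 0ℚ else ℕ→ℚ (rc I p k) * Point.xK z k
    edgePart : ∀ k → edgeSum (combo I ((l , x) ∷ rest)) k ≡ l * edgeSum x k + edgeSum y k
    edgePart k = if-linear (𝒮 k) {l} (Σℚ-linear l (λ j → scale-linear (crosses I p k j) l _ _)) (0≡l*0+0 l)
    componentPart : ∀ k → componentSum (combo I ((l , x) ∷ rest)) k ≡ l * componentSum x k + componentSum y k
    componentPart k = if-linear (𝒮 k) {l} (0≡l*0+0 l) (scale-linear (ℕ→ℚ (rc I p k)) l _ _)

combo-lower-bound : ∀ (I : Instance) (f : Point I → ℚ) → f (combo I []) ≡ 0ℚ →
  (∀ l x rest → f (combo I ((l , x) ∷ rest)) ≡ l * f x + f (combo I rest)) →
  ∀ {A : Set} (point : A → Point I) (c : ℚ) (cs : List (ℚ × A)) →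
  All (λ q → (0ℚ ≤ proj₁ q) × (c ≤ f (point (proj₂ q)))) cs →
  c * foldr (λ q acc → proj₁ q + acc) 0ℚ cs ≤ f (combo I (map (λ q → proj₁ q , point (proj₂ q)) cs))
combo-lower-bound I f f[]≡0 f∷≡ point c [] [] = ℚ.≤-reflexive (trans (ℚ.*-zeroʳ c) (sym f[]≡0))
combo-lower-bound I f f[]≡0 f∷≡ point c ((l , a) ∷ cs) ((0≤l , c≤fa) ∷ bounds) = begin
  c * (l + Λ)                          ≡⟨ solve 3 (λ c l Λ → c :* (l :+ Λ) := l :* c :+ c :* Λ) refl c l Λ ⟩
  l * c + c * Λ                        ≤⟨ ℚ.+-mono-≤ (ℚ.*-monoˡ-≤-nonNeg l {{nonNegative 0≤l}} c≤fa)
                                                     (combo-lower-bound I f f[]≡0 f∷≡ point c cs bounds) ⟩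
  l * f (point a) + f (combo I rest)   ≡⟨ f∷≡ l (point a) rest ⟨
  f (combo I ((l , point a) ∷ rest))   ∎
  where
  open ℚ.≤-Reasoning
  open +-*-Solver
  Λ : ℚ
  Λ = foldr (λ q acc → proj₁ q + acc) 0ℚ cs
  rest : List (ℚ × Point I)
  rest = map (λ q → proj₁ q , point (proj₂ q)) cs

mainTheorem3 : (I : Instance) → WellFormed I → (𝒮 : Fin (Instance.m I) → Bool) →
    ((𝒯 : Fin (Instance.m I) → Bool) → IsSteinerTree I 𝒯 →
      (p : Fin (Instance.n I) → ℕ) →
      ℕ→ℚ (rbar I p) - 1ℚ ≤ lhs I 𝒮 p (incVec I 𝒮 𝒯))
    ×
    ((cs : List (ℚ × (Fin (Instance.m I) → Bool))) →
      All (λ c → (0ℚ ≤ proj₁ c) × IsSteinerTree I (proj₂ c)) cs →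
      foldr (λ c acc → proj₁ c + acc) 0ℚ cs ≡ 1ℚ →
      (p : Fin (Instance.n I) → ℕ) →
      ℕ→ℚ (rbar I p) - 1ℚ ≤ lhs I 𝒮 p (combo I (map (λ c → proj₁ c , incVec I 𝒮 (proj₂ c)) cs)))
mainTheorem3 I wf 𝒮 = treeInequality , hullInequality
  where
  treeInequality : ∀ 𝒯 → IsSteinerTree I 𝒯 → ∀ p → ℕ→ℚ (rbar I p) - 1ℚ ≤ lhs I 𝒮 p (incVec I 𝒮 𝒯)
  treeInequality 𝒯 tree p = Contraction.incVec-inequality I wf 𝒮 𝒯 p tree

  hullInequality : ∀ cs → All (λ c → (0ℚ ≤ proj₁ c) × IsSteinerTree I (proj₂ c)) cs →
    foldr (λ c acc → proj₁ c + acc) 0ℚ cs ≡ 1ℚ → ∀ p →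
    ℕ→ℚ (rbar I p) - 1ℚ ≤ lhs I 𝒮 p (combo I (map (λ c → proj₁ c , incVec I 𝒮 (proj₂ c)) cs))
  hullInequality cs weightedTrees Σλ≡1 p =
    subst (_≤ lhs I 𝒮 p _) (trans (cong (bound *_) Σλ≡1) (ℚ.*-identityʳ bound))
      (combo-lower-bound I (lhs I 𝒮 p) lhs-combo-[] lhs-combo-∷ (incVec I 𝒮) bound cs
        (All.map (Prod.map₂ λ tree → treeInequality _ tree p) weightedTrees))
    where
    open Linearity I 𝒮 p
    bound : ℚ
    bound = ℕ→ℚ (rbar I p) - 1ℚ
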